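{- Let $p\equiv 1\pmod 4$ be a prime. There exists a nontrivial residue class mod $p$ if and only if there exists $n\in\mathbb{F}_p$ such that $n$, $n+1$ and $n+2$ are all nonzero squares in $\mathbb{F}_p$.
   Context: $\mathbb{F}_p$ denotes the field of residues modulo $p$. A nontrivial residue class mod $p$ is a $3\times 3$ grid $$\begin{array}{c|c|c} x_1^2 & x_2^2 & x_3^2\\ \hline x_4^2 & 0 & x_6^2\\ \hline x_7^2 & x_8^2 & x_9^2\end{array}$$ with $x_1,\dots,x_4,x_6,\dots,x_9\in\mathbb{F}_p$ all nonzero, whose central entry is $0$, and such that the entries of each row, each column and each of the two main diagonals sum to $0$ in $\mathbb{F}_p$ (i.e. a solution over $\mathbb{F}_p$ of the magic-square-of-squares relations with central entry and total $0$, in which only the central entry is zero). -}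

module Defs where

open import Data.Nat using (ℕ; NonZero)
open import Data.Nat.DivMod using (_mod_)
open import Data.Fin using (Fin; toℕ)
open import Data.Product using (Σ; ∃; _×_; _,_)
open import Relation.Binary.PropositionalEquality using (_≡_)
open import Relation.Nullary using (¬_)
import Data.Nat as ℕ

𝔽 : ℕ → Set
𝔽 p = Fin p

module _ {p : ℕ} .{{_ : NonZero p}} where

  0F : 𝔽 p
  0F = 0 mod p

  1F : 𝔽 p
  1F = 1 mod p

  2F : 𝔽 p
  2F = 2 mod p

  infixl 6 _+F_
  infixl 7 _*F_

  _+F_ : 𝔽 p → 𝔽 p → 𝔽 p
  x +F y = (toℕ x ℕ.+ toℕ y) mod p

  _*F_ : 𝔽 p → 𝔽 p → 𝔽 p
  x *F y = (toℕ x ℕ.* toℕ y) mod p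

  sq : 𝔽 p → 𝔽 p
  sq x = x *F x

  IsNonzeroSquare : 𝔽 p → Set
  IsNonzeroSquare n = ¬ (n ≡ 0F) × ∃ λ (x : 𝔽 p) → sq x ≡ n

  -- A nontrivial residue class mod p: nonzero x₁,…,x₄,x₆,…,x₉ ∈ 𝔽_p such that
  -- the grid  x₁² x₂² x₃² / x₄² 0 x₆² / x₇² x₈² x₉²  has all rows, columns and
  -- both main diagonals summing to 0.
  record NontrivialResidueClass : Set where
    field
      x₁ x₂ x₃ x₄ x₆ x₇ x₈ x₉ : 𝔽 p
      x₁≢0 : ¬ (x₁ ≡ 0F)
      x₂≢0 : ¬ (x₂ ≡ 0F)
      x₃≢0 : ¬ (x₃ ≡ 0F)
      x₄≢0 : ¬ (x₄ ≡ 0F)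
      x₆≢0 : ¬ (x₆ ≡ 0F)
      x₇≢0 : ¬ (x₇ ≡ 0F)
      x₈≢0 : ¬ (x₈ ≡ 0F)
      x₉≢0 : ¬ (x₉ ≡ 0F)
      row₁ : sq x₁ +F sq x₂ +F sq x₃ ≡ 0F
      row₂ : sq x₄ +F 0F +F sq x₆ ≡ 0F
      row₃ : sq x₇ +F sq x₈ +F sq x₉ ≡ 0F
      col₁ : sq x₁ +F sq x₄ +F sq x₇ ≡ 0F
      col₂ : sq x₂ +F 0F +F sq x₈ ≡ 0F
      col₃ : sq x₃ +F sq x₆ +F sq x₉ ≡ 0F
      diag₁ : sq x₁ +F 0F +F sq x₉ ≡ 0F
      diag₂ : sq x₃ +F 0F +F sq x₇ ≡ 0F

-- (⇒) Write a, b, c, d, f, g for the squares of x₁, x₂, x₃, x₄, x₆, x₇.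
-- The first row and the second diagonal give a + b = g, the first column and the
-- middle row give a + g = f; dividing by a, the numbers b/a, g/a, f/a are the
-- consecutive nonzero squares n, n + 1, n + 2.
-- (⇐) As p ≡ 1 (mod 4) there is an i with i² = −1, and for n = u², n + 1 = v²,
-- n + 2 = w² the grid of squares of  1, u, iv / iw, 0, w / v, iu, i  is
--     1      n      −(n+1)
--   −(n+2)   0      n + 2
--    n + 1  −n      −1
-- To find i, let h = (p − 1)/2 and pair each x ∈ {1,…,h} with the unique y ∈ {1,…,h}
-- with xy ≡ ±1.  This is an involution fixing 1; on {2,…,h}, a set of odd size h − 1,
-- it must have a fixed point x, and x² ≡ 1 being impossible there, x² ≡ −1.
module Submission where

open import Defs
open import Data.Bool using (Bool; true; false; if_then_else_)
open import Data.Empty using (⊥-elim)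
open import Data.Fin using (toℕ)
open import Data.Fin.Properties using (toℕ-injective; toℕ<n; toℕ-fromℕ<)
open import Data.Nat
open import Data.Nat.Properties
open import Data.Nat.DivMod
open import Data.Nat.Divisibility using (_∣_; ∣1⇒≡1; m%n≡0⇒n∣m; n∣m⇒m%n≡0; n∣m*n)
open import Data.Nat.Primality using (Prime; euclidsLemma; ¬prime[1])
open import Data.Nat.Coprimality using (prime⇒coprime; coprime-Bézout)
open import Data.Nat.GCD using (module Bézout)
open import Data.Nat.Tactic.RingSolver using (solve-∀)
open import Data.Product using (∃; _×_; _,_; proj₁; proj₂)
open import Data.Sum using (_⊎_; inj₁; inj₂; [_,_]′)
import Data.Sum as Sum
open import Function using (_∘_; id)
open import Function.Bundles using (_⇔_; mk⇔)
open import Level using (0ℓ)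
open import Relation.Binary using (Rel; Setoid)
import Relation.Binary.Construct.On as On
import Relation.Binary.Reasoning.Setoid
open import Relation.Binary.PropositionalEquality
open import Relation.Nullary using (¬_; Dec; yes; no; contradiction)
open import Relation.Nullary.Decidable using (⌊_⌋; _×-dec_; _⊎-dec_)
open import Relation.Unary using (Pred; Decidable)
import Algebra.Properties.CommutativeSemigroup as CommutativeSemigroupProperties

module Congruence (p : ℕ) .{{_ : NonZero p}} where

  infix 4 _≈_
  _≈_ : Rel ℕ 0ℓ
  a ≈ b = a % p ≡ b % p

  ≈-setoid : Setoid 0ℓ 0ℓ
  ≈-setoid = On.setoid (setoid ℕ) (_% p)

  open Setoid ≈-setoid public using () renaming (refl to ≈-refl; sym to ≈-sym; trans to ≈-trans)
  module ≈-Reasoning = Relation.Binary.Reasoning.Setoid ≈-setoid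
  open ≈-Reasoning

  infix 4 _≈?_
  _≈?_ : ∀ a b → Dec (a ≈ b)
  a ≈? b = a % p ≟ b % p

  ≡⇒≈ : ∀ {a b} → a ≡ b → a ≈ b
  ≡⇒≈ = cong (_% p)

  %-≈ : ∀ a → a % p ≈ a
  %-≈ a = m%n%n≡m%n a p

  +-cong : ∀ {a b c d} → a ≈ b → c ≈ d → a + c ≈ b + d
  +-cong {a} {b} {c} {d} a≈b c≈d = begin
    a + c          ≈⟨ %-distribˡ-+ a c p ⟩
    a % p + c % p  ≡⟨ cong₂ _+_ a≈b c≈d ⟩
    b % p + d % p  ≈⟨ %-distribˡ-+ b d p ⟨
    b + d          ∎

  *-cong : ∀ {a b c d} → a ≈ b → c ≈ d → a * c ≈ b * d
  *-cong {a} {b} {c} {d} a≈b c≈d = begin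
    a * c              ≈⟨ %-distribˡ-* a c p ⟩
    (a % p) * (c % p)  ≡⟨ cong₂ _*_ a≈b c≈d ⟩
    (b % p) * (d % p)  ≈⟨ %-distribˡ-* b d p ⟨
    b * d              ∎

  0%p≡0 : 0 % p ≡ 0
  0%p≡0 = m<n⇒m%n≡m (>-nonZero⁻¹ p)

  ≈0⇒∣ : ∀ {a} → a ≈ 0 → p ∣ a
  ≈0⇒∣ {a} a≈0 = m%n≡0⇒n∣m a p (trans a≈0 0%p≡0)

  ∣⇒≈0 : ∀ {a} → p ∣ a → a ≈ 0
  ∣⇒≈0 {a} p∣a = trans (n∣m⇒m%n≡0 a p p∣a) (sym 0%p≡0)

  m*p≈0 : ∀ m → m * p ≈ 0
  m*p≈0 m = ∣⇒≈0 (n∣m*n m)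

  ≈⇒≡ : ∀ {a b} → a < p → b < p → a ≈ b → a ≡ b
  ≈⇒≡ a<p b<p a≈b = trans (sym (m<n⇒m%n≡m a<p)) (trans a≈b (m<n⇒m%n≡m b<p))

  0<a<p⇒a≉0 : ∀ {a} → 0 < a → a < p → ¬ a ≈ 0
  0<a<p⇒a≉0 0<a a<p a≈0 = >⇒≢ 0<a (≈⇒≡ a<p (>-nonZero⁻¹ p) a≈0)

  -- An additive inverse that avoids truncated subtraction.
  -_ : ℕ → ℕ
  - a = (p ∸ 1) * a

  +-inverseʳ : ∀ a → a + - a ≈ 0
  +-inverseʳ a = begin
    a + (p ∸ 1) * a  ≡⟨ cong (_* a) (m+[n∸m]≡n (>-nonZero⁻¹ p)) ⟩
    p * a            ≡⟨ *-comm p a ⟩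
    a * p            ≈⟨ m*p≈0 a ⟩
    0                ∎

  +-cancelʳ : ∀ {a b} c → a + c ≈ b + c → a ≈ b
  +-cancelʳ {a} {b} c a+c≈b+c = begin
    a                ≡⟨ +-identityʳ a ⟨
    a + 0            ≈⟨ +-cong (≈-refl {a}) (+-inverseʳ c) ⟨
    a + (c + - c)    ≡⟨ +-assoc a c (- c) ⟨
    a + c + - c      ≈⟨ +-cong a+c≈b+c (≈-refl { - c}) ⟩
    b + c + - c      ≡⟨ +-assoc b c (- c) ⟩
    b + (c + - c)    ≈⟨ +-cong (≈-refl {b}) (+-inverseʳ c) ⟩
    b + 0            ≡⟨ +-identityʳ b ⟩
    b                ∎

  *-‿distribˡ : ∀ a b → a * - b ≡ - (a * b)
  *-‿distribˡ a b = x[yz]≡y[xz] a (p ∸ 1) b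
    where
    x[yz]≡y[xz] : ∀ x y z → x * (y * z) ≡ y * (x * z)
    x[yz]≡y[xz] = solve-∀

  +1≈0⇒-≈1 : ∀ {a} → a + 1 ≈ 0 → - a ≈ 1
  +1≈0⇒-≈1 {a} a+1≈0 = +-cancelʳ a (begin
    - a + a  ≡⟨ +-comm (- a) a ⟩
    a + - a  ≈⟨ +-inverseʳ a ⟩
    0        ≈⟨ a+1≈0 ⟨
    a + 1    ≡⟨ +-comm a 1 ⟩
    1 + a    ∎)

  ≈0⇒*≈0 : ∀ a {b} → b ≈ 0 → a * b ≈ 0
  ≈0⇒*≈0 a b≈0 = ≈-trans (*-cong (≈-refl {a}) b≈0) (≡⇒≈ (*-zeroʳ a))

  +≈0⇒≈ : ∀ {a b} c → a + c ≈ 0 → b + c ≈ 0 → a ≈ b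
  +≈0⇒≈ c a+c≈0 b+c≈0 = +-cancelʳ c (≈-trans a+c≈0 (≈-sym b+c≈0))

  module Field (p-prime : Prime p) where

    1≉0 : ¬ 1 ≈ 0
    1≉0 1≈0 = ¬prime[1] (subst Prime (∣1⇒≡1 (≈0⇒∣ 1≈0)) p-prime)

    *≈0⇒ : ∀ {a b} → a * b ≈ 0 → a ≈ 0 ⊎ b ≈ 0
    *≈0⇒ {a} {b} ab≈0 = Sum.map ∣⇒≈0 ∣⇒≈0 (euclidsLemma a b p-prime (≈0⇒∣ ab≈0))

    *-≉0 : ∀ {a b} → ¬ a ≈ 0 → ¬ b ≈ 0 → ¬ a * b ≈ 0
    *-≉0 a≉0 b≉0 ab≈0 = [ a≉0 , b≉0 ]′ (*≈0⇒ ab≈0)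

    *-inverse : ∀ {a} → ¬ a ≈ 0 → ∃ λ r → a * r ≈ 1
    *-inverse {a} a≉0 = fromBézout (coprime-Bézout (prime⇒coprime p-prime {{≢-nonZero a%p≢0}} (m%n<n a p)))
      where
      a%p≢0 : a % p ≢ 0
      a%p≢0 a%p≡0 = a≉0 (trans a%p≡0 (sym 0%p≡0))
      fromBézout : Bézout.Identity 1 p (a % p) → ∃ λ r → a * r ≈ 1
      fromBézout (Bézout.+- x y 1+y[a%p]≡xp) = - y , (begin
        a * - y    ≡⟨ *-‿distribˡ a y ⟩
        - (a * y)  ≈⟨ +1≈0⇒-≈1 (begin
          a * y + 1          ≈⟨ +-cong (*-cong (≈-sym (%-≈ a)) (≈-refl {y})) (≈-refl {1}) ⟩
          (a % p) * y + 1    ≡⟨ +-comm _ 1 ⟩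
          1 + (a % p) * y    ≡⟨ cong (1 +_) (*-comm (a % p) y) ⟩
          1 + y * (a % p)    ≡⟨ 1+y[a%p]≡xp ⟩
          x * p              ≈⟨ m*p≈0 x ⟩
          0                  ∎) ⟩
        1          ∎)
      fromBézout (Bézout.-+ x y 1+xp≡y[a%p]) = y , (begin
        a * y            ≈⟨ *-cong (≈-sym (%-≈ a)) (≈-refl {y}) ⟩
        (a % p) * y      ≡⟨ *-comm (a % p) y ⟩
        y * (a % p)      ≡⟨ 1+xp≡y[a%p] ⟨
        1 + x * p        ≈⟨ +-cong (≈-refl {1}) (m*p≈0 x) ⟩
        1 + 0            ∎)

    *-cancelʳ : ∀ {a b c} → ¬ c ≈ 0 → a * c ≈ b * c → a ≈ b
    *-cancelʳ {a} {b} {c} c≉0 ac≈bc = begin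
      a            ≡⟨ *-identityʳ a ⟨
      a * 1        ≈⟨ *-cong (≈-refl {a}) cr≈1 ⟨
      a * (c * r)  ≡⟨ *-assoc a c r ⟨
      a * c * r    ≈⟨ *-cong ac≈bc (≈-refl {r}) ⟩
      b * c * r    ≡⟨ *-assoc b c r ⟩
      b * (c * r)  ≈⟨ *-cong (≈-refl {b}) cr≈1 ⟩
      b * 1        ≡⟨ *-identityʳ b ⟩
      b            ∎
      where
      r : ℕ
      r = proj₁ (*-inverse c≉0)
      cr≈1 : c * r ≈ 1
      cr≈1 = proj₂ (*-inverse c≉0)

    x*x≈1⇒x≈±1 : ∀ {x} → x * x ≈ 1 → x ≈ 1 ⊎ x + 1 ≈ 0
    x*x≈1⇒x≈±1 {zero}   0≈1 = inj₁ 0≈1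
    x*x≈1⇒x≈±1 {suc x′} x²≈1 with *≈0⇒ {x′} {suc x′ + 1} (+-cancelʳ 1 (begin
      x′ * (suc x′ + 1) + 1  ≡⟨ square-1+n x′ ⟨
      suc x′ * suc x′        ≈⟨ x²≈1 ⟩
      1                      ∎))
      where
      square-1+n : ∀ n → suc n * suc n ≡ n * (suc n + 1) + 1
      square-1+n = solve-∀
    ... | inj₁ x′≈0 = inj₁ (+-cong (≈-refl {1}) x′≈0)
    ... | inj₂ x+1≈0 = inj₂ x+1≈0

module Counting where

  count : ℕ → (ℕ → Bool) → ℕ
  count zero    D = 0
  count (suc n) D = (if D n then 1 else 0) + count n D

  infixl 5 _∖_
  _∖_ : (ℕ → Bool) → ℕ → ℕ → Bool
  (D ∖ x) y = if ⌊ y ≟ x ⌋ then false else D y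

  ∖-intro : ∀ D {x y} → y ≢ x → D y ≡ true → (D ∖ x) y ≡ true
  ∖-intro D {x} {y} y≢x Dy with y ≟ x
  ... | yes y≡x = contradiction y≡x y≢x
  ... | no _    = Dy

  ∖-elim : ∀ D {x y} → (D ∖ x) y ≡ true → y ≢ x × D y ≡ true
  ∖-elim D {x} {y} D∖xy with y ≟ x
  ... | no y≢x = y≢x , D∖xy

  count-cong : ∀ n {D E} → (∀ {y} → y < n → D y ≡ E y) → count n D ≡ count n E
  count-cong zero    D≗E = refl
  count-cong (suc n) D≗E =
    cong₂ (λ b c → (if b then 1 else 0) + c) (D≗E ≤-refl) (count-cong n (λ y<n → D≗E (m<n⇒m<1+n y<n)))

  count-∖ : ∀ {n D x} → x < n → D x ≡ true → suc (count n (D ∖ x)) ≡ count n D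
  count-∖ {suc n} {D} {x} x<1+n Dx with n ≟ x
  ... | yes refl rewrite Dx = cong suc (count-cong n ∖-below)
    where
    ∖-below : ∀ {y} → y < n → (D ∖ n) y ≡ D y
    ∖-below {y} y<n with y ≟ n
    ... | yes refl = contradiction y<n (<-irrefl refl)
    ... | no _     = refl
  ... | no n≢x = trans (sym (+-suc _ _)) (cong ((if D n then 1 else 0) +_) (count-∖ x<n Dx))
    where
    x<n : x < n
    x<n = ≤∧≢⇒< (≤-pred x<1+n) (n≢x ∘ sym)

  count≡suc⇒∃ : ∀ n D {c} → count n D ≡ suc c → ∃ λ x → D x ≡ true
  count≡suc⇒∃ (suc n) D count≡suc with D n in Dn
  ... | true  = n , Dn
  ... | false = count≡suc⇒∃ n D count≡suc

  between : ℕ → ℕ → ℕ → Bool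
  between a b y = ⌊ (a ≤? y) ×-dec (y ≤? b) ⌋

  between-intro : ∀ {a b y} → a ≤ y → y ≤ b → between a b y ≡ true
  between-intro {a} {b} {y} a≤y y≤b with (a ≤? y) ×-dec (y ≤? b)
  ... | yes _ = refl
  ... | no ¬a≤y≤b = contradiction (a≤y , y≤b) ¬a≤y≤b

  between-elim : ∀ {a b y} → between a b y ≡ true → a ≤ y × y ≤ b
  between-elim {a} {b} {y} _ with (a ≤? y) ×-dec (y ≤? b)
  ... | yes a≤y≤b = a≤y≤b

  count-between : ∀ a b n → n ≤ suc b → count n (between a b) ≡ n ∸ a
  count-between a b zero    _     = sym (0∸n≡0 a)
  count-between a b (suc n) n<1+b with (a ≤? n) ×-dec (n ≤? b)
  ... | yes (a≤n , _) = trans (cong suc (count-between a b n (<⇒≤ n<1+b))) (sym (+-∸-assoc 1 a≤n))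
  ... | no ¬a≤n≤b     = begin
    count n (between a b)  ≡⟨ count-between a b n (<⇒≤ n<1+b) ⟩
    n ∸ a                  ≡⟨ m≤n⇒m∸n≡0 (<⇒≤ n<a) ⟩
    0                      ≡⟨ m≤n⇒m∸n≡0 n<a ⟨
    suc n ∸ a              ∎
    where
    open ≡-Reasoning
    n<a : n < a
    n<a = ≰⇒> (λ a≤n → ¬a≤n≤b (a≤n , ≤-pred n<1+b))

  record IsFixedPointFreeInvolution (σ : ℕ → ℕ) (n : ℕ) (D : ℕ → Bool) : Set where
    field
      bounded      : ∀ {x} → D x ≡ true → x < n
      closed       : ∀ {x} → D x ≡ true → D (σ x) ≡ true
      involutive   : ∀ {x} → D x ≡ true → σ (σ x) ≡ x
      fixedPointFree : ∀ {x} → D x ≡ true → σ x ≢ x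

  module _ {σ : ℕ → ℕ} {n : ℕ} {D : ℕ → Bool} (inv : IsFixedPointFreeInvolution σ n D) where
    open IsFixedPointFreeInvolution inv

    ∖-orbit : ∀ {x} → D x ≡ true →
              IsFixedPointFreeInvolution σ n (D ∖ x ∖ σ x) × 2 + count n (D ∖ x ∖ σ x) ≡ count n D
    ∖-orbit {x} Dx = record
      { bounded        = bounded ∘ in-D
      ; closed         = closed′
      ; involutive     = involutive ∘ in-D
      ; fixedPointFree = fixedPointFree ∘ in-D
      } , trans (cong suc (count-∖ (bounded Dσx) (∖-intro D (fixedPointFree Dx) Dσx)))
                (count-∖ (bounded Dx) Dx)
      where
      Dσx : D (σ x) ≡ true
      Dσx = closed Dx
      in-D : ∀ {y} → (D ∖ x ∖ σ x) y ≡ true → D y ≡ true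
      in-D D′y = proj₂ (∖-elim D (proj₂ (∖-elim (D ∖ x) D′y)))
      closed′ : ∀ {y} → (D ∖ x ∖ σ x) y ≡ true → (D ∖ x ∖ σ x) (σ y) ≡ true
      closed′ {y} D′y with ∖-elim (D ∖ x) D′y
      ... | y≢σx , D∖xy with ∖-elim D D∖xy
      ... | y≢x , Dy = ∖-intro (D ∖ x) σy≢σx (∖-intro D σy≢x (closed Dy))
        where
        σy≢x : σ y ≢ x
        σy≢x σy≡x = y≢σx (trans (sym (involutive Dy)) (cong σ σy≡x))
        σy≢σx : σ y ≢ σ x
        σy≢σx σy≡σx = y≢x (trans (sym (involutive Dy)) (trans (cong σ σy≡σx) (involutive Dx)))

  count-even : ∀ {σ n D} → IsFixedPointFreeInvolution σ n D → ∃ λ m → count n D ≡ 2 * m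
  count-even {σ} {n} {D} inv = go (count n D) inv refl
    where
    go : ∀ c {D} → IsFixedPointFreeInvolution σ n D → count n D ≡ c → ∃ λ m → c ≡ 2 * m
    go zero    _   _          = 0 , refl
    go (suc c) {D} inv count≡1+c with count≡suc⇒∃ n D count≡1+c
    ... | x , Dx with ∖-orbit inv Dx
    ...   | inv′ , 2+count′≡count with c | trans 2+count′≡count count≡1+c
    ...     | zero   | ()
    ...     | suc c′ | 2+count′≡2+c′ with go c′ inv′ (suc-injective (suc-injective 2+count′≡2+c′))
    ...       | m , c′≡2m = suc m , trans (cong (2 +_) c′≡2m) (sym (*-suc 2 m))

module _ {P : Pred ℕ 0ℓ} (P? : Decidable P) where

  choose : ℕ → ℕ
  choose v with anyUpTo? P? v
  ... | yes (n , _) = n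
  ... | no _        = 0

  choose-spec : ∀ {v} → ∃ (λ n → n < v × P n) → P (choose v)
  choose-spec {v} ∃n with anyUpTo? P? v
  ... | yes (_ , _ , Pn) = Pn
  ... | no ∄n            = contradiction ∃n ∄n

module SquareRootOfMinusOne (p : ℕ) .{{_ : NonZero p}} (p-prime : Prime p) (p%4≡1 : p % 4 ≡ 1) where
  open Congruence p
  open Field p-prime
  open ≈-Reasoning
  open Counting

  k : ℕ
  k = p / 4

  h : ℕ
  h = 2 * k

  p≡1+h+h : p ≡ suc (h + h)
  p≡1+h+h = trans (m≡m%n+[m/n]*n p 4) (trans (cong (_+ k * 4) p%4≡1) (1+4k≡1+2k+2k k))
    where
    1+4k≡1+2k+2k : ∀ k → 1 + k * 4 ≡ suc (2 * k + 2 * k)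
    1+4k≡1+2k+2k = solve-∀

  k≢0 : k ≢ 0
  k≢0 k≡0 = ¬prime[1] (subst Prime (trans p≡1+h+h (cong (λ k → suc (2 * k + 2 * k)) k≡0)) p-prime)

  h∸1≡1+2[k-1] : h ∸ 1 ≡ suc (2 * pred k)
  h∸1≡1+2[k-1] = subst (λ k → 2 * k ∸ 1 ≡ suc (2 * pred k)) (suc-pred k {{≢-nonZero k≢0}})
                        (+-suc (pred k) (pred k + 0))

  0<h : 0 < h
  0<h = *-monoʳ-< 2 (n≢0⇒n>0 k≢0)

  h<p : h < p
  h<p = subst (h <_) (sym p≡1+h+h) (s≤s (m≤m+n h h))

  1+h<p : suc h < p
  1+h<p = subst (suc h <_) (sym p≡1+h+h) (s≤s (m<m+n h 0<h))

  Half : ℕ → Set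
  Half y = 1 ≤ y × y ≤ h

  Half⇒<p : ∀ {y} → Half y → y < p
  Half⇒<p (_ , y≤h) = ≤-<-trans y≤h h<p

  Half⇒≉0 : ∀ {y} → Half y → ¬ y ≈ 0
  Half⇒≉0 half@(1≤y , _) = 0<a<p⇒a≉0 1≤y (Half⇒<p half)

  Half-1 : Half 1
  Half-1 = ≤-refl , 0<h

  infix 4 _≈±1
  _≈±1 : ℕ → Set
  a ≈±1 = a ≈ 1 ⊎ a + 1 ≈ 0

  ≈±1-comm : ∀ a b → a * b ≈±1 → b * a ≈±1
  ≈±1-comm a b = subst _≈±1 (*-comm a b)

  Partner : ℕ → ℕ → Set
  Partner x y = Half y × x * y ≈±1

  Partner? : ∀ x → Decidable (Partner x)
  Partner? x y = ((1 ≤? y) ×-dec (y ≤? h)) ×-dec ((x * y ≈? 1) ⊎-dec (x * y + 1 ≈? 0))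

  partner-exists : ∀ {x} → Half x → ∃ λ y → y < suc h × Partner x y
  partner-exists {x} half = partnerOf (r′ ≤? h)
    where
    r : ℕ
    r = proj₁ (*-inverse (Half⇒≉0 half))
    r′ : ℕ
    r′ = r % p
    r′<p : r′ < p
    r′<p = m%n<n r p
    xr′≈1 : x * r′ ≈ 1
    xr′≈1 = ≈-trans (*-cong (≈-refl {x}) (%-≈ r)) (proj₂ (*-inverse (Half⇒≉0 half)))
    r′≢0 : r′ ≢ 0
    r′≢0 r′≡0 = 1≉0 (≈-trans (≈-sym xr′≈1) (≈0⇒*≈0 x (≡⇒≈ r′≡0)))
    partnerOf : Dec (r′ ≤ h) → ∃ λ y → y < suc h × Partner x y
    partnerOf (yes r′≤h) = r′ , s≤s r′≤h , (n≢0⇒n>0 r′≢0 , r′≤h) , inj₁ xr′≈1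
    partnerOf (no r′≰h)  = p ∸ r′ , s≤s p∸r′≤h , (m<n⇒0<n∸m r′<p , p∸r′≤h) , inj₂ (begin
      x * (p ∸ r′) + 1       ≈⟨ +-cong (≈-refl {x * (p ∸ r′)}) xr′≈1 ⟨
      x * (p ∸ r′) + x * r′  ≡⟨ *-distribˡ-+ x (p ∸ r′) r′ ⟨
      x * (p ∸ r′ + r′)      ≡⟨ cong (x *_) (m∸n+n≡m (<⇒≤ r′<p)) ⟩
      x * p                  ≈⟨ m*p≈0 x ⟩
      0                      ∎)
      where
      p∸r′≤h : p ∸ r′ ≤ h
      p∸r′≤h = ≤-trans (∸-monoʳ-≤ p (≰⇒> r′≰h))
                 (≤-reflexive (trans (cong (_∸ suc h) p≡1+h+h) (m+n∸n≡m h h)))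

  opposite-signs : ∀ {x y z} → Half x → Half z → x * y ≈ 1 → z * y + 1 ≈ 0 → y ≈ 0
  opposite-signs {x} {y} {z} (1≤x , x≤h) (_ , z≤h) xy≈1 zy+1≈0 =
    [ ⊥-elim ∘ x+z≉0 , id ]′ (*≈0⇒ [x+z]y≈0)
    where
    [x+z]y≈0 : (x + z) * y ≈ 0
    [x+z]y≈0 = begin
      (x + z) * y    ≡⟨ *-distribʳ-+ y x z ⟩
      x * y + z * y  ≡⟨ +-comm (x * y) (z * y) ⟩
      z * y + x * y  ≈⟨ +-cong (≈-refl {z * y}) xy≈1 ⟩
      z * y + 1      ≈⟨ zy+1≈0 ⟩
      0              ∎
    x+z≉0 : ¬ x + z ≈ 0
    x+z≉0 = 0<a<p⇒a≉0 (≤-trans 1≤x (m≤m+n x z))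
              (subst (x + z <_) (sym p≡1+h+h) (s≤s (+-mono-≤ x≤h z≤h)))

  partner-unique : ∀ {x y z} → Half x → Half z → ¬ y ≈ 0 → x * y ≈±1 → z * y ≈±1 → x ≡ z
  partner-unique hx hz y≉0 (inj₁ xy≈1)   (inj₁ zy≈1)   =
    ≈⇒≡ (Half⇒<p hx) (Half⇒<p hz) (*-cancelʳ y≉0 (≈-trans xy≈1 (≈-sym zy≈1)))
  partner-unique hx hz y≉0 (inj₂ xy+1≈0) (inj₂ zy+1≈0) =
    ≈⇒≡ (Half⇒<p hx) (Half⇒<p hz) (*-cancelʳ y≉0 (+-cancelʳ 1 (≈-trans xy+1≈0 (≈-sym zy+1≈0))))
  partner-unique hx hz y≉0 (inj₁ xy≈1)   (inj₂ zy+1≈0) =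
    contradiction (opposite-signs hx hz xy≈1 zy+1≈0) y≉0
  partner-unique hx hz y≉0 (inj₂ xy+1≈0) (inj₁ zy≈1)   =
    contradiction (opposite-signs hz hx zy≈1 xy+1≈0) y≉0

  partner : ℕ → ℕ
  partner x = choose (Partner? x) (suc h)

  partner-spec : ∀ {x} → Half x → Partner x (partner x)
  partner-spec {x} = choose-spec (Partner? x) ∘ partner-exists

  partner-involutive : ∀ {x} → Half x → partner (partner x) ≡ x
  partner-involutive {x} hx = partner-unique half-x″ hx (Half⇒≉0 half-x′)
    (≈±1-comm (partner x) (partner (partner x)) x′*x″≈±1) x*x′≈±1
    where
    half-x′ : Half (partner x)
    half-x′ = proj₁ (partner-spec hx)
    x*x′≈±1 : x * partner x ≈±1
    x*x′≈±1 = proj₂ (partner-spec hx)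
    half-x″ : Half (partner (partner x))
    half-x″ = proj₁ (partner-spec half-x′)
    x′*x″≈±1 : partner x * partner (partner x) ≈±1
    x′*x″≈±1 = proj₂ (partner-spec half-x′)

  partner-1 : partner 1 ≡ 1
  partner-1 = partner-unique (proj₁ 1′) Half-1 1≉0 (≈±1-comm 1 (partner 1) (proj₂ 1′)) (inj₁ refl)
    where
    1′ : Partner 1 (partner 1)
    1′ = partner-spec Half-1

  x*x≉1 : ∀ {x} → 2 ≤ x → x ≤ h → ¬ x * x ≈ 1
  x*x≉1 {x} 2≤x x≤h x²≈1 with x*x≈1⇒x≈±1 x²≈1
  ... | inj₁ x≈1   = <⇒≢ 2≤x (sym (≈⇒≡ (≤-<-trans x≤h h<p) (Half⇒<p Half-1) x≈1))
  ... | inj₂ x+1≈0 = 0<a<p⇒a≉0 (m≤n+m 1 x) x+1<p x+1≈0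
    where
    x+1<p : x + 1 < p
    x+1<p = subst (_< p) (+-comm 1 x) (<-≤-trans (s≤s (s≤s x≤h)) 1+h<p)

  partner-isInvolution : (∀ {x} → 2 ≤ x → x ≤ h → ¬ x * x + 1 ≈ 0) →
                         IsFixedPointFreeInvolution partner (suc h) (between 2 h)
  partner-isInvolution no-root = record
    { bounded        = s≤s ∘ proj₂ ∘ between-elim
    ; closed         = closed
    ; involutive     = partner-involutive ∘ half ∘ between-elim
    ; fixedPointFree = fixedPointFree ∘ between-elim
    }
    where
    half : ∀ {x} → 2 ≤ x × x ≤ h → Half x
    half (2≤x , x≤h) = ≤-trans (n≤1+n 1) 2≤x , x≤h
    closed : ∀ {x} → between 2 h x ≡ true → between 2 h (partner x) ≡ true
    closed {x} x∈ with between-elim x∈ | partner-spec (half (between-elim x∈))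
    ... | 2≤x , _ | (1≤x′ , x′≤h) , _ = between-intro (≤∧≢⇒< 1≤x′ (x′≢1 ∘ sym)) x′≤h
      where
      x′≢1 : partner x ≢ 1
      x′≢1 x′≡1 = <⇒≢ 2≤x (trans (sym partner-1) (trans (cong partner (sym x′≡1))
                                                        (partner-involutive (half (between-elim x∈)))))
    fixedPointFree : ∀ {x} → 2 ≤ x × x ≤ h → partner x ≢ x
    fixedPointFree {x} x∈@(2≤x , x≤h) x′≡x
      with subst (λ y → x * y ≈±1) x′≡x (proj₂ (partner-spec (half x∈)))
    ... | inj₁ x²≈1   = x*x≉1 2≤x x≤h x²≈1
    ... | inj₂ x²+1≈0 = no-root 2≤x x≤h x²+1≈0

  count-between-2-h : count (suc h) (between 2 h) ≡ suc (2 * pred k)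
  count-between-2-h = trans (count-between 2 h (suc h) ≤-refl) h∸1≡1+2[k-1]

  √-1 : ∃ λ i → i * i + 1 ≈ 0
  √-1 with anyUpTo? (λ i → i * i + 1 ≈? 0) (suc h)
  ... | yes (i , _ , i²+1≈0) = i , i²+1≈0
  ... | no ∄root with count-even (partner-isInvolution no-root)
    where
    no-root : ∀ {x} → 2 ≤ x → x ≤ h → ¬ x * x + 1 ≈ 0
    no-root _ x≤h x²+1≈0 = ∄root (_ , s≤s x≤h , x²+1≈0)
  ...   | m , count≡2m = ⊥-elim (even≢odd m (pred k) (trans (sym count≡2m) count-between-2-h))

module Residues (p : ℕ) .{{_ : NonZero p}} where
  open Congruence p

  ConsecutiveNonzeroSquares : Set
  ConsecutiveNonzeroSquares =
    ∃ λ (n : 𝔽 p) → IsNonzeroSquare n × IsNonzeroSquare (n +F 1F) × IsNonzeroSquare (n +F 2F)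

  toℕ-mod : ∀ m → toℕ (m mod p) ≈ m
  toℕ-mod m = trans (cong (_% p) (toℕ-fromℕ< (m%n<n m p))) (%-≈ m)

  toℕ-+F : ∀ (x y : 𝔽 p) → toℕ (x +F y) ≈ toℕ x + toℕ y
  toℕ-+F x y = toℕ-mod (toℕ x + toℕ y)

  toℕ-sq : ∀ (x : 𝔽 p) → toℕ (sq x) ≈ toℕ x * toℕ x
  toℕ-sq x = toℕ-mod (toℕ x * toℕ x)

  ≈⇒≡F : ∀ {x y : 𝔽 p} → toℕ x ≈ toℕ y → x ≡ y
  ≈⇒≡F {x} {y} x≈y = toℕ-injective (≈⇒≡ (toℕ<n x) (toℕ<n y) x≈y)

  ≡0F⇒≈0 : ∀ {x : 𝔽 p} → x ≡ 0F → toℕ x ≈ 0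
  ≡0F⇒≈0 refl = toℕ-mod 0

  ≈0⇒≡0F : ∀ {x : 𝔽 p} → toℕ x ≈ 0 → x ≡ 0F
  ≈0⇒≡0F x≈0 = ≈⇒≡F (≈-trans x≈0 (≈-sym (toℕ-mod 0)))

  ≢0F⇒≉0 : ∀ {x : 𝔽 p} → x ≢ 0F → ¬ toℕ x ≈ 0
  ≢0F⇒≉0 x≢0F = x≢0F ∘ ≈0⇒≡0F

  ≉0⇒≢0F : ∀ {x : 𝔽 p} → ¬ toℕ x ≈ 0 → x ≢ 0F
  ≉0⇒≢0F x≉0 = x≉0 ∘ ≡0F⇒≈0

  toℕ-+F-+F : ∀ {x y z : 𝔽 p} {a b c} → toℕ x ≈ a → toℕ y ≈ b → toℕ z ≈ c →
              toℕ (x +F y +F z) ≈ a + b + c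
  toℕ-+F-+F {x} {y} {z} x≈a y≈b z≈c =
    ≈-trans (toℕ-+F (x +F y) z) (+-cong (≈-trans (toℕ-+F x y) (+-cong x≈a y≈b)) z≈c)

  sumSq≈0 : ∀ (x y z : 𝔽 p) → sq x +F sq y +F sq z ≡ 0F →
            toℕ x * toℕ x + toℕ y * toℕ y + toℕ z * toℕ z ≈ 0
  sumSq≈0 x y z line≡0 =
    ≈-trans (≈-sym (toℕ-+F-+F (toℕ-sq x) (toℕ-sq y) (toℕ-sq z))) (≡0F⇒≈0 line≡0)

  sumSq₀≈0 : ∀ (x z : 𝔽 p) → sq x +F 0F +F sq z ≡ 0F → toℕ x * toℕ x + toℕ z * toℕ z ≈ 0
  sumSq₀≈0 x z line≡0 =
    ≈-trans (≡⇒≈ (cong (_+ toℕ z * toℕ z) (sym (+-identityʳ (toℕ x * toℕ x)))))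
      (≈-trans (≈-sym (toℕ-+F-+F (toℕ-sq x) (toℕ-mod 0) (toℕ-sq z))) (≡0F⇒≈0 line≡0))

  +F-+F≡0F : ∀ {x y z : 𝔽 p} {a b c} → toℕ x ≈ a → toℕ y ≈ b → toℕ z ≈ c → a + b + c ≈ 0 →
             x +F y +F z ≡ 0F
  +F-+F≡0F x≈a y≈b z≈c a+b+c≈0 = ≈0⇒≡0F (≈-trans (toℕ-+F-+F x≈a y≈b z≈c) a+b+c≈0)

  module _ (R : NontrivialResidueClass {p}) where
    open NontrivialResidueClass R

    x₁²+x₂²≈x₇² : toℕ x₁ * toℕ x₁ + toℕ x₂ * toℕ x₂ ≈ toℕ x₇ * toℕ x₇
    x₁²+x₂²≈x₇² = +≈0⇒≈ (toℕ x₃ * toℕ x₃) (sumSq≈0 x₁ x₂ x₃ row₁)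
      (≈-trans (≡⇒≈ (+-comm (toℕ x₇ * toℕ x₇) _)) (sumSq₀≈0 x₃ x₇ diag₂))

    x₁²+x₇²≈x₆² : toℕ x₁ * toℕ x₁ + toℕ x₇ * toℕ x₇ ≈ toℕ x₆ * toℕ x₆
    x₁²+x₇²≈x₆² = +≈0⇒≈ (toℕ x₄ * toℕ x₄)
      (≈-trans (≡⇒≈ (xy∙z≈xz∙y (toℕ x₁ * toℕ x₁) (toℕ x₇ * toℕ x₇) _)) (sumSq≈0 x₁ x₄ x₇ col₁))
      (≈-trans (≡⇒≈ (+-comm (toℕ x₆ * toℕ x₆) _)) (sumSq₀≈0 x₄ x₆ row₂))
      where open CommutativeSemigroupProperties +-commutativeSemigroup using (xy∙z≈xz∙y)

  root-≢0F : ∀ {y m : 𝔽 p} → sq y ≡ m → m ≢ 0F → y ≢ 0F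
  root-≢0F {y} refl y²≢0F y≡0F = y²≢0F (≈0⇒≡0F (≈-trans (toℕ-sq y) (*-cong y≈0 y≈0)))
    where
    y≈0 : toℕ y ≈ 0
    y≈0 = ≡0F⇒≈0 y≡0F

  module _ (p-prime : Prime p) where
    open Field p-prime

    1F≢0F : 1F {p} ≢ 0F
    1F≢0F = ≉0⇒≢0F (1≉0 ∘ ≈-trans (≈-sym (toℕ-mod 1)))

    isNonzeroSquare : ∀ {m : 𝔽 p} w → ¬ w ≈ 0 → toℕ m ≈ w * w → IsNonzeroSquare m
    isNonzeroSquare {m} w w≉0 m≈w² =
      ≉0⇒≢0F (λ m≈0 → *-≉0 w≉0 w≉0 (≈-trans (≈-sym m≈w²) m≈0)) ,
      w mod p ,
      ≈⇒≡F (≈-trans (toℕ-sq (w mod p)) (≈-trans (*-cong (toℕ-mod w) (toℕ-mod w)) (≈-sym m≈w²)))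

    sumOfSquares-scaled : ∀ u v w {i} → u * i ≈ 1 → u * u + v * v ≈ w * w →
                          (v * i) * (v * i) + 1 ≈ (w * i) * (w * i)
    sumOfSquares-scaled u v w {i} ui≈1 u²+v²≈w² = begin
      (v * i) * (v * i) + 1                  ≈⟨ +-cong (≈-refl {(v * i) * (v * i)}) (*-cong ui≈1 ui≈1) ⟨
      (v * i) * (v * i) + (u * i) * (u * i)  ≡⟨ factor u v i ⟩
      (u * u + v * v) * (i * i)              ≈⟨ *-cong u²+v²≈w² (≈-refl {i * i}) ⟩
      (w * w) * (i * i)                      ≡⟨ unfactor w i ⟩
      (w * i) * (w * i)                      ∎
      where
      open ≈-Reasoning
      factor : ∀ u v i → (v * i) * (v * i) + (u * i) * (u * i) ≡ (u * u + v * v) * (i * i)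
      factor = solve-∀
      unfactor : ∀ w i → (w * w) * (i * i) ≡ (w * i) * (w * i)
      unfactor = solve-∀

    consecutiveSquares : NontrivialResidueClass {p} → ConsecutiveNonzeroSquares
    consecutiveSquares R =
      n , isNonzeroSquare u u≉0 n≈u² , isNonzeroSquare v v≉0 n+1≈v² , isNonzeroSquare w w≉0 n+2≈w²
      where
      open NontrivialResidueClass R
      open ≈-Reasoning
      i : ℕ
      i = proj₁ (*-inverse (≢0F⇒≉0 x₁≢0))
      x₁i≈1 : toℕ x₁ * i ≈ 1
      x₁i≈1 = proj₂ (*-inverse (≢0F⇒≉0 x₁≢0))
      i≉0 : ¬ i ≈ 0
      i≉0 i≈0 = 1≉0 (≈-trans (≈-sym x₁i≈1) (≈0⇒*≈0 (toℕ x₁) i≈0))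
      u v w : ℕ
      u = toℕ x₂ * i
      v = toℕ x₇ * i
      w = toℕ x₆ * i
      u≉0 : ¬ u ≈ 0
      u≉0 = *-≉0 (≢0F⇒≉0 x₂≢0) i≉0
      v≉0 : ¬ v ≈ 0
      v≉0 = *-≉0 (≢0F⇒≉0 x₇≢0) i≉0
      w≉0 : ¬ w ≈ 0
      w≉0 = *-≉0 (≢0F⇒≉0 x₆≢0) i≉0
      u²+1≈v² : u * u + 1 ≈ v * v
      u²+1≈v² = sumOfSquares-scaled (toℕ x₁) (toℕ x₂) (toℕ x₇) x₁i≈1 (x₁²+x₂²≈x₇² R)
      v²+1≈w² : v * v + 1 ≈ w * w
      v²+1≈w² = sumOfSquares-scaled (toℕ x₁) (toℕ x₇) (toℕ x₆) x₁i≈1 (x₁²+x₇²≈x₆² R)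
      n : 𝔽 p
      n = sq (u mod p)
      n≈u² : toℕ n ≈ u * u
      n≈u² = ≈-trans (toℕ-sq (u mod p)) (*-cong (toℕ-mod u) (toℕ-mod u))
      n+1≈v² : toℕ (n +F 1F) ≈ v * v
      n+1≈v² = begin
        toℕ (n +F 1F)   ≈⟨ toℕ-+F n 1F ⟩
        toℕ n + toℕ 1F  ≈⟨ +-cong n≈u² (toℕ-mod 1) ⟩
        u * u + 1       ≈⟨ u²+1≈v² ⟩
        v * v           ∎
      n+2≈w² : toℕ (n +F 2F) ≈ w * w
      n+2≈w² = begin
        toℕ (n +F 2F)   ≈⟨ toℕ-+F n 2F ⟩
        toℕ n + toℕ 2F  ≈⟨ +-cong n≈u² (toℕ-mod 2) ⟩
        u * u + 2       ≡⟨ +-assoc (u * u) 1 1 ⟨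
        u * u + 1 + 1   ≈⟨ +-cong u²+1≈v² (≈-refl {1}) ⟩
        v * v + 1       ≈⟨ v²+1≈w² ⟩
        w * w           ∎

    module _ (i : ℕ) (i²+1≈0 : i * i + 1 ≈ 0) where

      i·_ : 𝔽 p → 𝔽 p
      i· y = (i * toℕ y) mod p

      i≉0 : ¬ i ≈ 0
      i≉0 i≈0 = 1≉0 (≈-trans (≈-sym (+-cong (*-cong i≈0 i≈0) (≈-refl {1}))) i²+1≈0)

      i·-≢0F : ∀ {y} → y ≢ 0F → i· y ≢ 0F
      i·-≢0F y≢0F = ≉0⇒≢0F (*-≉0 i≉0 (≢0F⇒≉0 y≢0F) ∘ ≈-trans (≈-sym (toℕ-mod _)))

      sq-i· : ∀ y {t} → toℕ (sq y) ≈ t → toℕ (sq (i· y)) ≈ i * i * t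
      sq-i· y {t} y²≈t = begin
        toℕ (sq (i· y))                ≈⟨ toℕ-sq (i· y) ⟩
        toℕ (i· y) * toℕ (i· y)        ≈⟨ *-cong (toℕ-mod (i * toℕ y)) (toℕ-mod (i * toℕ y)) ⟩
        (i * toℕ y) * (i * toℕ y)      ≡⟨ interchange i (toℕ y) ⟩
        i * i * (toℕ y * toℕ y)        ≈⟨ *-cong (≈-refl {i * i}) (≈-trans (≈-sym (toℕ-sq y)) y²≈t) ⟩
        i * i * t                      ∎
        where
        open ≈-Reasoning
        interchange : ∀ i y → (i * y) * (i * y) ≡ i * i * (y * y)
        interchange = solve-∀

      vanishes : ∀ {e} t → e ≡ t * (i * i + 1) → e ≈ 0
      vanishes t e≡t[i²+1] = ≈-trans (≡⇒≈ e≡t[i²+1]) (≈0⇒*≈0 t i²+1≈0)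

      residueClass : ConsecutiveNonzeroSquares → NontrivialResidueClass {p}
      residueClass (n , (n≢0 , u , u²≡n) , (n+1≢0 , v , v²≡n+1) , (n+2≢0 , w , w²≡n+2)) = record
        { x₁ = 1F ; x₂ = u ; x₃ = i· v ; x₄ = i· w ; x₆ = w ; x₇ = v ; x₈ = i· u ; x₉ = i· 1F
        ; x₁≢0 = 1F≢0F
        ; x₂≢0 = u≢0
        ; x₃≢0 = i·-≢0F v≢0
        ; x₄≢0 = i·-≢0F w≢0
        ; x₆≢0 = w≢0
        ; x₇≢0 = v≢0
        ; x₈≢0 = i·-≢0F u≢0
        ; x₉≢0 = i·-≢0F 1F≢0F
        ; row₁  = +F-+F≡0F sq-1 sq-u (sq-i· v sq-v) (vanishes (N + 1) (row₁-identity N i))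
        ; row₂  = +F-+F≡0F (sq-i· w sq-w) 0≈0 sq-w (vanishes (N + 2) (row₂-identity N i))
        ; row₃  = +F-+F≡0F sq-v (sq-i· u sq-u) (sq-i· 1F sq-1) (vanishes (N + 1) (row₃-identity N i))
        ; col₁  = +F-+F≡0F sq-1 (sq-i· w sq-w) sq-v (vanishes (N + 2) (col₁-identity N i))
        ; col₂  = +F-+F≡0F sq-u 0≈0 (sq-i· u sq-u) (vanishes N (col₂-identity N i))
        ; col₃  = +F-+F≡0F (sq-i· v sq-v) sq-w (sq-i· 1F sq-1) (vanishes (N + 2) (col₃-identity N i))
        ; diag₁ = +F-+F≡0F sq-1 0≈0 (sq-i· 1F sq-1) (vanishes 1 (diag₁-identity i))
        ; diag₂ = +F-+F≡0F (sq-i· v sq-v) 0≈0 sq-v (vanishes (N + 1) (diag₂-identity N i))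
        }
        where
        N : ℕ
        N = toℕ n
        u≢0 : u ≢ 0F
        u≢0 = root-≢0F u²≡n n≢0
        v≢0 : v ≢ 0F
        v≢0 = root-≢0F v²≡n+1 n+1≢0
        w≢0 : w ≢ 0F
        w≢0 = root-≢0F w²≡n+2 n+2≢0
        0≈0 : toℕ (0F {p}) ≈ 0
        0≈0 = toℕ-mod 0
        sq-1 : toℕ (sq (1F {p})) ≈ 1
        sq-1 = ≈-trans (toℕ-sq 1F) (*-cong (toℕ-mod 1) (toℕ-mod 1))
        sq-u : toℕ (sq u) ≈ N
        sq-u = ≡⇒≈ (cong toℕ u²≡n)
        sq-v : toℕ (sq v) ≈ N + 1
        sq-v = ≈-trans (≡⇒≈ (cong toℕ v²≡n+1))
                 (≈-trans (toℕ-+F n 1F) (+-cong (≈-refl {N}) (toℕ-mod 1)))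
        sq-w : toℕ (sq w) ≈ N + 2
        sq-w = ≈-trans (≡⇒≈ (cong toℕ w²≡n+2))
                 (≈-trans (toℕ-+F n 2F) (+-cong (≈-refl {N}) (toℕ-mod 2)))
        row₁-identity : ∀ N i → 1 + N + i * i * (N + 1) ≡ (N + 1) * (i * i + 1)
        row₁-identity = solve-∀
        row₂-identity : ∀ N i → i * i * (N + 2) + 0 + (N + 2) ≡ (N + 2) * (i * i + 1)
        row₂-identity = solve-∀
        row₃-identity : ∀ N i → N + 1 + i * i * N + i * i * 1 ≡ (N + 1) * (i * i + 1)
        row₃-identity = solve-∀
        col₁-identity : ∀ N i → 1 + i * i * (N + 2) + (N + 1) ≡ (N + 2) * (i * i + 1)
        col₁-identity = solve-∀
        col₂-identity : ∀ N i → N + 0 + i * i * N ≡ N * (i * i + 1)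
        col₂-identity = solve-∀
        col₃-identity : ∀ N i → i * i * (N + 1) + (N + 2) + i * i * 1 ≡ (N + 2) * (i * i + 1)
        col₃-identity = solve-∀
        diag₁-identity : ∀ i → 1 + 0 + i * i * 1 ≡ 1 * (i * i + 1)
        diag₁-identity = solve-∀
        diag₂-identity : ∀ N i → i * i * (N + 1) + 0 + (N + 1) ≡ (N + 1) * (i * i + 1)
        diag₂-identity = solve-∀

corollary5p1 : (p : ℕ) .{{_ : NonZero p}} → Prime p → p % 4 ≡ 1 →
    (NontrivialResidueClass {p} ⇔
      (∃ λ (n : 𝔽 p) → IsNonzeroSquare n × IsNonzeroSquare (n +F 1F) × IsNonzeroSquare (n +F 2F)))
corollary5p1 p p-prime p%4≡1 with SquareRootOfMinusOne.√-1 p p-prime p%4≡1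
... | i , i²+1≈0 = mk⇔ (Residues.consecutiveSquares p p-prime) (Residues.residueClass p p-prime i i²+1≈0)
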